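{- In the setting described in the context, let $c$ be a vertex of $G$ and $H_i$ a region. Then $m^i_c-\ell_c\le g_c-\ell_c$ if $\hat c$ is an internal vertex of $H_i$, and $m^i_c-\ell_c\le 0$ otherwise.
   Context: Let $\mathcal K$ be a nontrivial minor-closed graph family and $G\in\mathcal K$ with nonnegative edge weights and shortest-path distance $\mathrm{dist}$; $C\subseteq V(G)$ is the client set, $f>0$ a facility cost, $p>0$ an integer, $\mathrm{cost}(S)=|S|f+\sum_{x\in C}(\min_{u\in S}\mathrm{dist}(x,u))^p$. Let $\mathcal L$ be a solution output by the local search (start from any $S\subseteq V(G)$; while some $S'$ with $|S\setminus S'|+|S'\setminus S|\le s$ has $\mathrm{cost}(S')\le(1-\varepsilon/|C|)\mathrm{cost}(S)$, set $S\gets S'$), and $\mathcal G$ a minimum-cost solution. Let $\mathcal F=\mathcal L\cup\mathcal G$ and $r=1/\varepsilon^2$. Fix a priority order on $V(G)$; for $v\in\mathcal F$ the Voronoi cell $V_{\mathcal F}(v)$ is the set of vertices closer to $v$ than to other vertices of $\mathcal F$ (ties to highest priority). $G_{\mathrm{Vor}(\mathcal F)}$ is obtained by contracting every edge of each $G[V_{\mathcal F}(v)]$; $\hat u$ denotes the vertex into which the cell containing $u$ is contracted. A weak $r$-division of a graph $K$ (constants $c_1,c_2$) is a collection of subgraphs (regions) such that each edge lies in exactly one region, there are at most $c_1|V(K)|/r$ regions, each has at most $r$ vertices, and the total over regions of boundary vertices (vertices of the region with an incident edge not in the region) is at most $c_2|V(K)|/r^{1/2}$; non-boundary vertices of a region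 are internal. Let $H_1,\dots,H_\kappa$ be the regions of a weak $r$-division of $G_{\mathrm{Vor}(\mathcal F)}$. Let $V_i=\{v\in\mathcal F:\hat v\in V(H_i)\}$, $B_i=\{v\in\mathcal F:\hat v\text{ is a boundary vertex of }H_i\}$, $\mathcal G'=\mathcal G\cup\bigcup_i B_i$, $\mathcal L_i=\mathcal L\cap V_i$, $\mathcal G'_i=\mathcal G'\cap V_i$, and $\mathcal M^i=(\mathcal L\setminus\mathcal L_i)\cup\mathcal G'_i$. For a vertex $c$, $\ell_c$, $g_c$ and $m^i_c$ denote the distance from $c$ to the closest facility in $\mathcal L$, $\mathcal G$ and $\mathcal M^i$ respectively.
   Formalization: The edge weights, the facility cost f, the parameter ε (hence r = 1/ε²) and the weak r-division constants c₁, c₂ are rational. -}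

module Defs where

open import Data.Nat as ℕ using (ℕ; zero; suc)
open import Data.Fin using (Fin)
open import Data.Fin.Subset using (Subset; _∈_; _∪_; _∩_; _─_; ∣_∣; ⋃)
open import Data.Vec using (lookup; tabulate)
open import Data.List using (List; allFin; foldr; map)
open import Data.Bool.ListAction using (any)
open import Data.Nat.ListAction using (sum)
open import Data.List.Membership.Propositional using () renaming (_∈_ to _∈ₗ_)
open import Data.List.Relation.Unary.All using (All)
open import Data.Bool using (Bool; true; false; _∧_; not; if_then_else_)
open import Data.Product using (Σ; ∃; ∃₂; _×_; _,_; proj₁; proj₂)
open import Data.Sum using (_⊎_; inj₁; inj₂)
open import Relation.Nullary using (¬_)
open import Relation.Binary.PropositionalEquality using (_≡_; _≢_; refl; sym)
open import Data.Rational as ℚ using (ℚ; 0ℚ; 1ℚ)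
open import Data.Integer using (+_)

private
  variable
    n : ℕ

ℕtoℚ : ℕ → ℚ
ℕtoℚ k = (+ k) ℚ./ 1

-- q / k  (only used with k ≥ 1; the value for k = 0 is irrelevant)
divℕ : ℚ → ℕ → ℚ
divℕ q zero    = 0ℚ
divℕ q (suc k) = q ℚ.* ((+ 1) ℚ./ suc k)

powℚ : ℚ → ℕ → ℚ
powℚ q zero    = 1ℚ
powℚ q (suc p) = q ℚ.* powℚ q p

data ℚ∞ : Set where
  fin : ℚ → ℚ∞
  ∞   : ℚ∞

infix 4 _≤∞_ _<∞_
data _≤∞_ : ℚ∞ → ℚ∞ → Set where
  fin≤fin : ∀ {a b} → a ℚ.≤ b → fin a ≤∞ fin b
  _≤∞∞    : ∀ x → x ≤∞ ∞

data _<∞_ : ℚ∞ → ℚ∞ → Set where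
  fin<fin : ∀ {a b} → a ℚ.< b → fin a <∞ fin b
  fin<∞   : ∀ {a} → fin a <∞ ∞

infixl 6 _+∞_
_+∞_ : ℚ∞ → ℚ∞ → ℚ∞
fin a +∞ fin b = fin (a ℚ.+ b)
fin a +∞ ∞     = ∞
∞     +∞ y     = ∞

_⊓∞_ : ℚ∞ → ℚ∞ → ℚ∞
fin a ⊓∞ fin b = fin (a ℚ.⊓ b)
fin a ⊓∞ ∞     = fin a
∞     ⊓∞ y     = y

_^∞_ : ℚ∞ → ℕ → ℚ∞
fin q ^∞ p = fin (powℚ q p)
∞     ^∞ p = ∞

scale∞ : ℚ → ℚ∞ → ℚ∞
scale∞ q (fin a) = fin (q ℚ.* a)
scale∞ q ∞       = ∞

_-∞_ : ℚ∞ → ℚ → ℚ∞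
fin a -∞ l = fin (a ℚ.- l)
∞     -∞ l = ∞

sumOver : Subset n → (Fin n → ℚ∞) → ℚ∞
sumOver {n} S h = foldr (λ x acc → if lookup S x then h x +∞ acc else acc) (fin 0ℚ) (allFin n)

-- min over an empty set is ∞
minOver : Subset n → (Fin n → ℚ∞) → ℚ∞
minOver {n} S h = foldr (λ x acc → if lookup S x then h x ⊓∞ acc else acc) ∞ (allFin n)

-- Edge-weighted graphs on vertex set Fin n (undirected edges x–y of weight w)

Edges : ℕ → Set
Edges n = List (Fin n × Fin n × ℚ)

NonNegWeights : Edges n → Set
NonNegWeights E = All (λ e → 0ℚ ℚ.≤ proj₂ (proj₂ e)) E

WAdj : Edges n → Fin n → Fin n → ℚ → Set
WAdj E x y w = ((x , y , w) ∈ₗ E) ⊎ ((y , x , w) ∈ₗ E)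

data Walk (E : Edges n) : Fin n → Fin n → ℚ → Set where
  stay : ∀ {x} → Walk E x x 0ℚ
  step : ∀ {x y z w l} → WAdj E x y w → Walk E y z l → Walk E x z (w ℚ.+ l)

IsShortestPathDist : (E : Edges n) → (Fin n → Fin n → ℚ∞) → Set
IsShortestPathDist E d = ∀ x y →
  (∀ l → Walk E x y l → d x y ≤∞ fin l) ×
  (d x y ≡ ∞ ⊎ Σ ℚ (λ l → d x y ≡ fin l × Walk E x y l))

record SGraph : Set₁ where
  field
    size       : ℕ
    adj        : Fin size → Fin size → Set
    adj-sym    : ∀ {x y} → adj x y → adj y x
    adj-irrefl : ∀ {x} → ¬ adj x x
open SGraph public

data Path {n : ℕ} (R : Fin n → Fin n → Set) (P : Fin n → Set) : Fin n → Fin n → Set where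
  nil  : ∀ {x} → P x → Path R P x x
  cons : ∀ {x y z} → P x → R x y → Path R P y z → Path R P x z

-- H is a minor of G: a minor model (disjoint nonempty connected branch sets)
IsMinorOf : SGraph → SGraph → Set
IsMinorOf H G = Σ (Fin (size H) → Subset (size G)) λ φ →
  (∀ v → ∃ λ x → x ∈ φ v) ×
  (∀ v w x → x ∈ φ v → x ∈ φ w → v ≡ w) ×
  (∀ v x y → x ∈ φ v → y ∈ φ v → Path (adj G) (_∈ φ v) x y) ×
  (∀ v w → adj H v w → ∃₂ λ x y → x ∈ φ v × y ∈ φ w × adj G x y)

MinorClosed : (SGraph → Set) → Set₁
MinorClosed 𝒦 = ∀ G H → 𝒦 G → IsMinorOf H G → 𝒦 H

Nontrivial : (SGraph → Set) → Set₁
Nontrivial 𝒦 = ∃ λ H → ¬ 𝒦 H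

UAdj : Edges n → Fin n → Fin n → Set
UAdj E x y = x ≢ y × ∃ λ w → WAdj E x y w

underlying : Edges n → SGraph
underlying {n} E = record
  { size = n
  ; adj = UAdj E
  ; adj-sym = λ { (ne , w , inj₁ m) → (λ eq → ne (sym eq)) , w , inj₂ m
                ; (ne , w , inj₂ m) → (λ eq → ne (sym eq)) , w , inj₁ m }
  ; adj-irrefl = λ { (ne , _) → ne refl }
  }

cost : (d : Fin n → Fin n → ℚ∞) (C : Subset n) (f : ℚ) (p : ℕ) → Subset n → ℚ∞
cost d C f p S = fin (ℕtoℚ ∣ S ∣ ℚ.* f) +∞ sumOver C (λ x → minOver S (d x) ^∞ p)

swapDist : Subset n → Subset n → ℕ
swapDist S S' = ∣ S ─ S' ∣ ℕ.+ ∣ S' ─ S ∣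

-- L is a possible output of the local search: its while-loop condition fails at L
IsLocalSearchOutput : (d : Fin n → Fin n → ℚ∞) (C : Subset n) (f : ℚ) (p s : ℕ) (ε : ℚ)
                      → Subset n → Set
IsLocalSearchOutput d C f p s ε L = ∀ S' → swapDist L S' ℕ.≤ s →
  ¬ (cost d C f p S' ≤∞ scale∞ (1ℚ ℚ.- divℕ ε ∣ C ∣) (cost d C f p L))

IsMinimumCost : (d : Fin n → Fin n → ℚ∞) (C : Subset n) (f : ℚ) (p : ℕ) → Subset n → Set
IsMinimumCost d C f p G = ∀ S → cost d C f p G ≤∞ cost d C f p S

-- u ∈ V_F(a); the priority order is prio (larger = higher priority)
InCell : (d : Fin n → Fin n → ℚ∞) (F : Subset n) (prio : Fin n → ℕ) → Fin n → Fin n → Set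
InCell d F prio a u = a ∈ F × (∀ w → w ∈ F → w ≢ a →
  (d u a <∞ d u w) ⊎ (d u a ≡ d u w × prio w ℕ.< prio a))

-- u and v get identified by contracting every edge of every G[V_F(a)]
SameContracted : (E : Edges n) (d : Fin n → Fin n → ℚ∞) (F : Subset n) (prio : Fin n → ℕ)
                 → Fin n → Fin n → Set
SameContracted E d F prio u v =
  u ≡ v ⊎ ∃ λ a → Path (UAdj E) (InCell d F prio a) u v

-- (k, hat, adjK) is the simple graph G_Vor(F) on vertex set Fin k, hat u = û
IsVoronoiContraction : (E : Edges n) (d : Fin n → Fin n → ℚ∞) (F : Subset n) (prio : Fin n → ℕ)
                       (k : ℕ) (hat : Fin n → Fin k) (adjK : Fin k → Fin k → Bool) → Set
IsVoronoiContraction E d F prio k hat adjK =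
  (∀ a → ∃ λ u → hat u ≡ a) ×
  (∀ u v → (hat u ≡ hat v → SameContracted E d F prio u v) ×
           (SameContracted E d F prio u v → hat u ≡ hat v)) ×
  (∀ a b → (adjK a b ≡ true → a ≢ b × ∃₂ λ x y → UAdj E x y × hat x ≡ a × hat y ≡ b) ×
           (a ≢ b × (∃₂ λ x y → UAdj E x y × hat x ≡ a × hat y ≡ b) → adjK a b ≡ true))

-- Weak r-divisions: regions j : Fin κ with vertex sets VS j and edge sets ES j

isBoundary : {k κ : ℕ} (adjK : Fin k → Fin k → Bool) (VS : Fin κ → Subset k)
             (ES : Fin κ → Fin k → Fin k → Bool) → Fin κ → Fin k → Bool
isBoundary {k} adjK VS ES j a =
  lookup (VS j) a ∧ any (λ b → adjK a b ∧ not (ES j a b)) (allFin k)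

boundary : {k κ : ℕ} (adjK : Fin k → Fin k → Bool) (VS : Fin κ → Subset k)
           (ES : Fin κ → Fin k → Fin k → Bool) → Fin κ → Subset k
boundary adjK VS ES j = tabulate (isBoundary adjK VS ES j)

IsInternal : {k κ : ℕ} (adjK : Fin k → Fin k → Bool) (VS : Fin κ → Subset k)
             (ES : Fin κ → Fin k → Fin k → Bool) → Fin κ → Fin k → Set
IsInternal adjK VS ES j a = lookup (VS j) a ≡ true × isBoundary adjK VS ES j a ≡ false

-- weak r-division of the graph (Fin k, adjK) with constants c₁ c₂, where r = 1/ε²
-- (so |V(K)|/r = |V(K)|·ε² and |V(K)|/r^{1/2} = |V(K)|·ε)
IsWeakRDivision : (k : ℕ) (adjK : Fin k → Fin k → Bool) (ε r c₁ c₂ : ℚ)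
                  (κ : ℕ) (VS : Fin κ → Subset k) (ES : Fin κ → Fin k → Fin k → Bool) → Set
IsWeakRDivision k adjK ε r c₁ c₂ κ VS ES =
  (∀ j a b → ES j a b ≡ true → adjK a b ≡ true × a ∈ VS j × b ∈ VS j) ×
  (∀ j a b → ES j a b ≡ ES j b a) ×
  (∀ a b → adjK a b ≡ true → ∃ λ j → ES j a b ≡ true) ×
  (∀ j j' a b → ES j a b ≡ true → ES j' a b ≡ true → j ≡ j') ×
  (ℕtoℚ κ ℚ.≤ c₁ ℚ.* ℕtoℚ k ℚ.* (ε ℚ.* ε)) ×
  (∀ j → ℕtoℚ ∣ VS j ∣ ℚ.≤ r) ×
  (ℕtoℚ (sum (map (λ j → ∣ boundary adjK VS ES j ∣) (allFin κ))) ℚ.≤ c₂ ℚ.* ℕtoℚ k ℚ.* ε)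

Vset : {k κ : ℕ} (F : Subset n) (hat : Fin n → Fin k) (VS : Fin κ → Subset k) → Fin κ → Subset n
Vset F hat VS i = tabulate (λ v → lookup F v ∧ lookup (VS i) (hat v))

Bset : {k κ : ℕ} (F : Subset n) (hat : Fin n → Fin k) (adjK : Fin k → Fin k → Bool)
       (VS : Fin κ → Subset k) (ES : Fin κ → Fin k → Fin k → Bool) → Fin κ → Subset n
Bset F hat adjK VS ES i = tabulate (λ v → lookup F v ∧ isBoundary adjK VS ES i (hat v))

Mset : {k κ : ℕ} (L G : Subset n) (hat : Fin n → Fin k) (adjK : Fin k → Fin k → Bool)
       (VS : Fin κ → Subset k) (ES : Fin κ → Fin k → Fin k → Bool) → Fin κ → Subset n
Mset {κ = κ} L G hat adjK VS ES i = (L ─ Lᵢ) ∪ G'ᵢ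
  where
    F   = L ∪ G
    Vᵢ  = Vset F hat VS i
    G'  = G ∪ ⋃ (map (Bset F hat adjK VS ES) (allFin κ))
    Lᵢ  = L ∩ Vᵢ
    G'ᵢ = G' ∩ Vᵢ

module Submission where

-- The only non-trivial case is when the facility that serves c
-- (t ∈ G resp. t ∈ L) lies on the other side of Hᵢ from c, i.e. exactly one of
-- ĉ, t̂ lies in Hᵢ.  Then a shortest c–t path has an edge x–x' with x̂ ∈ Hᵢ and
-- x̂' ∉ Hᵢ; this edge survives in G_Vor(F) but is not an edge of Hᵢ, so x̂ is a
-- boundary vertex.  The Voronoi owner a ∈ F of x satisfies â = x̂ (a shortest
-- x–a path stays inside the cell of a), so a ∈ Bᵢ ⊆ G'ᵢ ⊆ Mⁱ, and
--   dist(c,a) ≤ dist(c,x) + dist(x,a) ≤ dist(c,x) + dist(x,t) = dist(c,t).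

open import Defs
open import Data.Nat as ℕ using (ℕ; _≤_)
import Data.Nat.Properties as ℕP
open import Data.Fin using (Fin)
open import Data.Fin.Properties using (_≟_)
open import Data.Fin.Subset using (Subset; _∈_; _∉_; _∪_; _∩_; _─_; ⋃; ∣_∣; inside; outside)
open import Data.Fin.Subset.Properties using (_∈?_; x∈p∪q⁺; x∈p∩q⁺; x∈p∩q⁻)
open import Data.Vec using (_∷_; lookup; tabulate; here; there)
open import Data.Vec.Properties using ([]=⇒lookup; lookup⇒[]=; lookup∘tabulate)
open import Data.List using (List; []; _∷_; allFin; foldr; map)
open import Data.List.Membership.Propositional using (lose) renaming (_∈_ to _∈ₗ_)
open import Data.List.Membership.Propositional.Properties using (∈-allFin; ∈-map⁺)
open import Data.List.Relation.Unary.Any using (here; there)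
open import Data.List.Relation.Unary.Any.Properties using (any⁺)
open import Data.Bool using (Bool; true; false; _∧_; not; if_then_else_)
open import Data.Bool.ListAction using (any)
import Data.Bool.Properties as BoolP
open import Data.Product using (∃; _×_; _,_; proj₁; proj₂)
open import Data.Sum using (_⊎_; inj₁; inj₂)
open import Data.Empty using (⊥-elim)
open import Relation.Nullary using (¬_; yes; no)
open import Relation.Binary.PropositionalEquality
open import Relation.Binary.Bundles using (Preorder)
open import Relation.Binary.Definitions using (tri<; tri≈; tri>)
import Relation.Binary.Reasoning.Preorder as PreorderReasoning
open import Function.Bundles using (Equivalence)
open import Function.Definitions using (Injective)
open import Data.Rational using (ℚ; 0ℚ; 1ℚ; _<_; _*_)
import Data.Rational as ℚ
import Data.Rational.Properties as ℚP

≤∞-refl : ∀ {x} → x ≤∞ x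
≤∞-refl {fin a} = fin≤fin ℚP.≤-refl
≤∞-refl {∞}     = ∞ ≤∞∞

≤∞-trans : ∀ {x y z} → x ≤∞ y → y ≤∞ z → x ≤∞ z
≤∞-trans     (fin≤fin p) (fin≤fin q) = fin≤fin (ℚP.≤-trans p q)
≤∞-trans {x} _           (_ ≤∞∞)     = x ≤∞∞

≤∞-reflexive : ∀ {x y} → x ≡ y → x ≤∞ y
≤∞-reflexive refl = ≤∞-refl

≤∞-preorder : Preorder _ _ _
≤∞-preorder = record
  { isPreorder = record
    { isEquivalence = isEquivalence ; reflexive = ≤∞-reflexive ; trans = ≤∞-trans } }

open PreorderReasoning ≤∞-preorder

<∞⇒≤∞ : ∀ {x y} → x <∞ y → x ≤∞ y
<∞⇒≤∞ (fin<fin p) = fin≤fin (ℚP.<⇒≤ p)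
<∞⇒≤∞ fin<∞       = _ ≤∞∞

<∞-≤∞-trans : ∀ {x y z} → x <∞ y → y ≤∞ z → x <∞ z
<∞-≤∞-trans (fin<fin p) (fin≤fin q) = fin<fin (ℚP.<-≤-trans p q)
<∞-≤∞-trans (fin<fin p) (_ ≤∞∞)     = fin<∞
<∞-≤∞-trans fin<∞       (_ ≤∞∞)     = fin<∞

≤∞-<∞-trans : ∀ {x y z} → x ≤∞ y → y <∞ z → x <∞ z
≤∞-<∞-trans (fin≤fin p) (fin<fin q) = fin<fin (ℚP.≤-<-trans p q)
≤∞-<∞-trans (fin≤fin p) fin<∞       = fin<∞

<∞-irrefl : ∀ {x} → ¬ (x <∞ x)
<∞-irrefl (fin<fin p) = ℚP.<-irrefl refl p

<∞⇒≱∞ : ∀ {x y} → x <∞ y → ¬ (y ≤∞ x)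
<∞⇒≱∞ p q = <∞-irrefl (<∞-≤∞-trans p q)

compare∞ : ∀ x y → x <∞ y ⊎ x ≡ y ⊎ y <∞ x
compare∞ (fin a) (fin b) with ℚP.<-cmp a b
... | tri< p _ _    = inj₁ (fin<fin p)
... | tri≈ _ refl _ = inj₂ (inj₁ refl)
... | tri> _ _ p    = inj₂ (inj₂ (fin<fin p))
compare∞ (fin a) ∞ = inj₁ fin<∞
compare∞ ∞ (fin b) = inj₂ (inj₂ fin<∞)
compare∞ ∞ ∞       = inj₂ (inj₁ refl)

≤fin⇒fin : ∀ {x T} → x ≤∞ fin T → ∃ λ a → x ≡ fin a
≤fin⇒fin (fin≤fin {a} _) = a , refl

+∞≤fin⇒fin : ∀ x y {T} → (x +∞ y) ≤∞ fin T → (∃ λ a → x ≡ fin a) × (∃ λ b → y ≡ fin b)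
+∞≤fin⇒fin (fin a) (fin b) _ = (a , refl) , (b , refl)

+∞-mono : ∀ {x y u v} → x ≤∞ y → u ≤∞ v → (x +∞ u) ≤∞ (y +∞ v)
+∞-mono           (fin≤fin p) (fin≤fin q) = fin≤fin (ℚP.+-mono-≤ p q)
+∞-mono {fin a}   (fin≤fin p) (_ ≤∞∞)     = _ ≤∞∞
+∞-mono {fin a}   (_ ≤∞∞)     _           = _ ≤∞∞
+∞-mono {∞} {y}   (_ ≤∞∞)     _           = ∞ ≤∞∞

+∞-monoʳ-< : ∀ a {u v} → u <∞ v → (fin a +∞ u) <∞ (fin a +∞ v)
+∞-monoʳ-< a (fin<fin p) = fin<fin (ℚP.+-monoʳ-< a p)
+∞-monoʳ-< a fin<∞       = fin<∞

+∞-identityˡ : ∀ x → fin 0ℚ +∞ x ≡ x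
+∞-identityˡ (fin a) = cong fin (ℚP.+-identityˡ a)
+∞-identityˡ ∞       = refl

+∞-assoc-fin : ∀ x a b → (x +∞ fin a) +∞ fin b ≡ x +∞ fin (a ℚ.+ b)
+∞-assoc-fin (fin x) a b = cong fin (ℚP.+-assoc x a b)
+∞-assoc-fin ∞       a b = refl

-∞-mono : ∀ {x y} l → x ≤∞ y → (x -∞ l) ≤∞ (y -∞ l)
-∞-mono     l (fin≤fin p) = fin≤fin (ℚP.+-monoˡ-≤ (ℚ.- l) p)
-∞-mono {x} l (_ ≤∞∞)     = _ ≤∞∞

-∞-≤0 : ∀ {x} l → x ≤∞ fin l → (x -∞ l) ≤∞ fin 0ℚ
-∞-≤0 l (fin≤fin p) =
  fin≤fin (ℚP.≤-trans (ℚP.+-monoˡ-≤ (ℚ.- l) p) (ℚP.≤-reflexive (ℚP.+-inverseʳ l)))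

⊓∞-≤ˡ : ∀ x y → (x ⊓∞ y) ≤∞ x
⊓∞-≤ˡ (fin a) (fin b) = fin≤fin (ℚP.p⊓q≤p a b)
⊓∞-≤ˡ (fin a) ∞       = ≤∞-refl
⊓∞-≤ˡ ∞       y       = _ ≤∞∞

⊓∞-≤ʳ : ∀ x y → (x ⊓∞ y) ≤∞ y
⊓∞-≤ʳ (fin a) (fin b) = fin≤fin (ℚP.p⊓q≤q a b)
⊓∞-≤ʳ (fin a) ∞       = _ ≤∞∞
⊓∞-≤ʳ ∞       y       = ≤∞-refl

⊓∞-sel : ∀ x y → x ⊓∞ y ≡ x ⊎ x ⊓∞ y ≡ y
⊓∞-sel (fin a) (fin b) with ℚP.⊓-sel a b
... | inj₁ e = inj₁ (cong fin e)
... | inj₂ e = inj₂ (cong fin e)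
⊓∞-sel (fin a) ∞ = inj₁ refl
⊓∞-sel ∞       y = inj₂ refl

module _ {n : ℕ} (S : Subset n) (h : Fin n → ℚ∞) where

  private
    keepMin : Fin n → ℚ∞ → ℚ∞
    keepMin x acc = if lookup S x then h x ⊓∞ acc else acc

    minList-≤ : ∀ xs {a} → a ∈ₗ xs → lookup S a ≡ true → foldr keepMin ∞ xs ≤∞ h a
    minList-≤ (x ∷ xs) (here refl) a∈S rewrite a∈S = ⊓∞-≤ˡ (h x) (foldr keepMin ∞ xs)
    minList-≤ (x ∷ xs) (there a∈xs) a∈S with lookup S x
    ... | true  = ≤∞-trans (⊓∞-≤ʳ (h x) _) (minList-≤ xs a∈xs a∈S)
    ... | false = minList-≤ xs a∈xs a∈S

    minList-attained : ∀ xs → foldr keepMin ∞ xs ≡ ∞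
                              ⊎ ∃ λ a → lookup S a ≡ true × foldr keepMin ∞ xs ≡ h a
    minList-attained [] = inj₁ refl
    minList-attained (x ∷ xs) with lookup S x in x∈S
    ... | false = minList-attained xs
    ... | true with ⊓∞-sel (h x) (foldr keepMin ∞ xs) | minList-attained xs
    ...   | inj₁ min≡hx  | _                       = inj₂ (x , x∈S , min≡hx)
    ...   | inj₂ min≡rec | inj₁ rec≡∞              = inj₁ (trans min≡rec rec≡∞)
    ...   | inj₂ min≡rec | inj₂ (a , a∈S , rec≡ha) = inj₂ (a , a∈S , trans min≡rec rec≡ha)

  minOver-≤ : ∀ {a} → a ∈ S → minOver S h ≤∞ h a
  minOver-≤ a∈S = minList-≤ (allFin n) (∈-allFin _) ([]=⇒lookup a∈S)

  minOver-attained : minOver S h ≡ ∞ ⊎ ∃ λ a → a ∈ S × minOver S h ≡ h a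
  minOver-attained with minList-attained (allFin n)
  ... | inj₁ min≡∞              = inj₁ min≡∞
  ... | inj₂ (a , a∈S , min≡ha) = inj₂ (a , lookup⇒[]= a S a∈S , min≡ha)

module Geodesics {n : ℕ} (E : Edges n) (d : Fin n → Fin n → ℚ∞)
                 (spd : IsShortestPathDist E d) where

  walk-≤ : ∀ {x y l} → Walk E x y l → d x y ≤∞ fin l
  walk-≤ {x} {y} w = proj₁ (spd x y) _ w

  edge-≤ : ∀ {y z w} → WAdj E y z w → d y z ≤∞ fin w
  edge-≤ {w = w} e = subst (λ l → _ ≤∞ fin l) (ℚP.+-identityʳ w) (walk-≤ (step e stay))

  WAdj-sym : ∀ {x y w} → WAdj E x y w → WAdj E y x w
  WAdj-sym (inj₁ e) = inj₂ e
  WAdj-sym (inj₂ e) = inj₁ e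

  geodesic : ∀ {x y l} → d x y ≡ fin l → Walk E x y l
  geodesic {x} {y} dxy with proj₂ (spd x y)
  ... | inj₁ dxy≡∞ with trans (sym dxy) dxy≡∞
  ...   | ()
  geodesic dxy | inj₂ (l , dxy' , w) with trans (sym dxy) dxy'
  ...   | refl = w

  _++ʷ_ : ∀ {x y z l₁ l₂} → Walk E x y l₁ → Walk E y z l₂ → Walk E x z (l₁ ℚ.+ l₂)
  _++ʷ_ {l₂ = l₂} stay w₂ = subst (Walk E _ _) (sym (ℚP.+-identityˡ l₂)) w₂
  _++ʷ_ {l₂ = l₂} (step {w = w} {l = l} e rest) w₂ =
    subst (Walk E _ _) (sym (ℚP.+-assoc w l l₂)) (step e (rest ++ʷ w₂))

  triangle : ∀ x y z → d x z ≤∞ (d x y +∞ d y z)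
  triangle x y z with proj₂ (spd x y) | proj₂ (spd y z)
  ... | inj₁ dxy≡∞ | _ rewrite dxy≡∞ = _ ≤∞∞
  ... | inj₂ (l₁ , dxy≡ , w₁) | inj₁ dyz≡∞ rewrite dyz≡∞ | dxy≡ = _ ≤∞∞
  ... | inj₂ (l₁ , dxy≡ , w₁) | inj₂ (l₂ , dyz≡ , w₂) rewrite dxy≡ | dyz≡ = walk-≤ (w₁ ++ʷ w₂)

  source-≤ : ∀ c y → (d c c +∞ y) ≤∞ y
  source-≤ c y = begin
    d c c +∞ y    ≲⟨ +∞-mono (walk-≤ stay) ≤∞-refl ⟩
    fin 0ℚ +∞ y   ≡⟨ +∞-identityˡ y ⟩
    y             ∎

  Between : Fin n → Fin n → Fin n → Set
  Between c t y = (d c y +∞ d y t) ≤∞ d c t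

  source-between : ∀ c t → Between c t c
  source-between c t = source-≤ c (d c t)

  Tight : Fin n → Fin n → Fin n → ℚ → Set
  Tight c t y q = (d c y +∞ fin q) ≤∞ d c t

  tight-start : ∀ {c t l} → d c t ≡ fin l → Tight c t c l
  tight-start {c} {l = l} dct = ≤∞-trans (source-≤ c (fin l)) (≤∞-reflexive (sym dct))

  tight-step : ∀ {c t y z w q} → Tight c t y (w ℚ.+ q) → WAdj E y z w → Tight c t z q
  tight-step {c} {t} {y} {z} {w} {q} tight e = begin
    d c z +∞ fin q               ≲⟨ +∞-mono (≤∞-trans (triangle c y z) (+∞-mono ≤∞-refl (edge-≤ e))) ≤∞-refl ⟩
    (d c y +∞ fin w) +∞ fin q    ≡⟨ +∞-assoc-fin (d c y) w q ⟩
    d c y +∞ fin (w ℚ.+ q)       ≲⟨ tight ⟩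
    d c t                        ∎

  tight⇒between : ∀ {c t y q} → Walk E y t q → Tight c t y q → Between c t y
  tight⇒between rest tight = ≤∞-trans (+∞-mono ≤∞-refl (walk-≤ rest)) tight

  record Crossing (Q : Fin n → Bool) (c t : Fin n) : Set where
    field
      {u v}     : Fin n
      {weight}  : ℚ
      edge      : WAdj E u v weight
      changes   : Q u ≢ Q v
      u-between : Between c t u
      v-between : Between c t v

  -- Walk along a tight walk until the label of the next vertex agrees with Q t;
  -- the edge taken there is a crossing.
  crossing-on : (Q : Fin n → Bool) {c t y : Fin n} {q : ℚ} →
                Walk E y t q → Tight c t y q → Q y ≢ Q t → Crossing Q c t
  crossing-on Q stay _ Qy≢Qt = ⊥-elim (Qy≢Qt refl)
  crossing-on Q {t = t} (step {y = z} e rest) tight Qy≢Qt with Q z BoolP.≟ Q t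
  ... | no Qz≢Qt  = crossing-on Q rest (tight-step tight e) Qz≢Qt
  ... | yes Qz≡Qt = record
    { edge      = e
    ; changes   = λ Qy≡Qz → Qy≢Qt (trans Qy≡Qz Qz≡Qt)
    ; u-between = tight⇒between (step e rest) tight
    ; v-between = tight⇒between rest (tight-step tight e) }

  geodesic-crossing : (Q : Fin n → Bool) {c t : Fin n} {T : ℚ} →
                      Q c ≢ Q t → d c t ≡ fin T → Crossing Q c t
  geodesic-crossing Q Qc≢Qt dct = crossing-on Q (geodesic dct) (tight-start dct) Qc≢Qt

  module VoronoiCells (F : Subset n) (prio : Fin n → ℕ) (prio-inj : Injective _≡_ _≡_ prio) where

    Cell : Fin n → Fin n → Set
    Cell = InCell d F prio

    cell-order : ∀ {a x w} → Cell a x → w ∈ F → w ≢ a → d x w ≤∞ d x a →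
                 d x w ≡ d x a × prio w ℕ.< prio a
    cell-order (_ , owns) w∈F w≢a dxw≤dxa with owns _ w∈F w≢a
    ... | inj₁ dxa<dxw       = ⊥-elim (<∞⇒≱∞ dxa<dxw dxw≤dxa)
    ... | inj₂ (dxa≡dxw , ≺) = sym dxa≡dxw , ≺

    -- A vertex on a shortest path from x to its owner a also belongs to the cell of a:
    -- any facility beating a at y would, via y, beat a at x.
    between-in-cell : ∀ {a x y D} → Cell a x → d x a ≡ fin D → Between x a y → Cell a y
    between-in-cell {a} {x} {y} x∈a dxa btw = proj₁ x∈a , owns
      where
        dxy-fin : ∃ λ e → d x y ≡ fin e
        dxy-fin = proj₁ (+∞≤fin⇒fin (d x y) (d y a) (subst ((d x y +∞ d y a) ≤∞_) dxa btw))

        via-y≤ : ∀ w → d y w ≤∞ d y a → d x w ≤∞ d x a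
        via-y≤ w dyw≤dya = begin
          d x w            ≲⟨ triangle x y w ⟩
          d x y +∞ d y w   ≲⟨ +∞-mono ≤∞-refl dyw≤dya ⟩
          d x y +∞ d y a   ≲⟨ btw ⟩
          d x a            ∎

        via-y< : ∀ w → d y w <∞ d y a → d x w <∞ d x a
        via-y< w dyw<dya with dxy-fin
        ... | e , dxy = ≤∞-<∞-trans (triangle x y w)
          (<∞-≤∞-trans (subst (λ z → (z +∞ d y w) <∞ (z +∞ d y a)) (sym dxy) (+∞-monoʳ-< e dyw<dya)) btw)

        owns : ∀ w → w ∈ F → w ≢ a → (d y a <∞ d y w) ⊎ (d y a ≡ d y w × prio w ℕ.< prio a)
        owns w w∈F w≢a with compare∞ (d y a) (d y w)
        ... | inj₁ dya<dyw = inj₁ dya<dyw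
        ... | inj₂ (inj₂ dyw<dya) = ⊥-elim (<∞-irrefl
              (subst (_<∞ d x a) (proj₁ (cell-order x∈a w∈F w≢a (<∞⇒≤∞ strict))) strict))
          where strict = via-y< w dyw<dya
        ... | inj₂ (inj₁ dya≡dyw) with ℕP.<-cmp (prio w) (prio a)
        ...   | tri< ≺ _ _ = inj₂ (dya≡dyw , ≺)
        ...   | tri≈ _ prio≡ _ = ⊥-elim (w≢a (prio-inj prio≡))
        ...   | tri> _ _ ≻ = ⊥-elim (ℕP.<-asym ≻
                (proj₂ (cell-order x∈a w∈F w≢a (via-y≤ w (≤∞-reflexive (sym dya≡dyw))))))

    cell-path : ∀ {a x y D q} → Cell a x → d x a ≡ fin D →
                Walk E y a q → Tight x a y q → Path (UAdj E) (Cell a) y a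
    cell-path x∈a dxa stay tight = nil (between-in-cell x∈a dxa (tight⇒between stay tight))
    cell-path {y = y} x∈a dxa (step {y = z} {w = w} e rest) tight with y ≟ z
    ... | yes refl = cell-path x∈a dxa rest (tight-step tight e)
    ... | no y≢z   = cons (between-in-cell x∈a dxa (tight⇒between (step e rest) tight))
                          (y≢z , w , e) (cell-path x∈a dxa rest (tight-step tight e))

    contracted-with-owner : ∀ {a x D} → Cell a x → d x a ≡ fin D → SameContracted E d F prio x a
    contracted-with-owner x∈a dxa = inj₂ (_ , cell-path x∈a dxa (geodesic dxa) (tight-start dxa))

    Nearer : Fin n → Fin n → Fin n → Set
    Nearer x a w = (d x a <∞ d x w) ⊎ (d x a ≡ d x w × prio w ℕ.≤ prio a)

    nearer-refl : ∀ {x a} → Nearer x a a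
    nearer-refl = inj₂ (refl , ℕP.≤-refl)

    nearer-trans : ∀ {x a b w} → Nearer x a b → Nearer x b w → Nearer x a w
    nearer-trans     (inj₁ p)       (inj₁ q)        = inj₁ (<∞-≤∞-trans p (<∞⇒≤∞ q))
    nearer-trans {x} {a} (inj₁ p)   (inj₂ (e , _))  = inj₁ (subst (d x a <∞_) e p)
    nearer-trans {x} {w = w} (inj₂ (e , _)) (inj₁ q) = inj₁ (subst (_<∞ d x w) (sym e) q)
    nearer-trans     (inj₂ (e , p)) (inj₂ (e' , q)) = inj₂ (trans e e' , ℕP.≤-trans q p)

    nearer-total : ∀ x a b → Nearer x a b ⊎ Nearer x b a
    nearer-total x a b with compare∞ (d x a) (d x b)
    ... | inj₁ lt = inj₁ (inj₁ lt)
    ... | inj₂ (inj₂ gt) = inj₂ (inj₁ gt)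
    ... | inj₂ (inj₁ eq) with ℕP.≤-total (prio a) (prio b)
    ...   | inj₁ le = inj₂ (inj₂ (sym eq , le))
    ...   | inj₂ ge = inj₁ (inj₂ (eq , ge))

    nearest : ∀ x {t} → t ∈ F → (xs : List (Fin n)) →
              ∃ λ a → a ∈ F × Nearer x a t × (∀ w → w ∈ₗ xs → w ∈ F → Nearer x a w)
    nearest x {t} t∈F [] = t , t∈F , nearer-refl , λ _ ()
    nearest x t∈F (y ∷ ys) with nearest x t∈F ys
    ... | a , a∈F , a≤t , a≤ys with y ∈? F
    ...   | no y∉F = a , a∈F , a≤t , λ { _ (here refl) y∈F → ⊥-elim (y∉F y∈F) ; w (there w∈ys) → a≤ys w w∈ys }
    ...   | yes y∈F with nearer-total x a y
    ...     | inj₁ a≤y = a , a∈F , a≤t , λ { _ (here refl) _ → a≤y ; w (there w∈ys) → a≤ys w w∈ys }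
    ...     | inj₂ y≤a = y , y∈F , nearer-trans y≤a a≤t ,
                λ { _ (here refl) _ → nearer-refl ; w (there w∈ys) w∈F → nearer-trans y≤a (a≤ys w w∈ys w∈F) }

    owner : ∀ x {t} → t ∈ F → ∃ λ a → Cell a x × d x a ≤∞ d x t
    owner x t∈F with nearest x t∈F (allFin n)
    ... | a , a∈F , a≤t , a≤all = a , (a∈F , owns) , closer a≤t
      where
        closer : ∀ {w} → Nearer x a w → d x a ≤∞ d x w
        closer (inj₁ lt)      = <∞⇒≤∞ lt
        closer (inj₂ (e , _)) = ≤∞-reflexive e

        owns : ∀ w → w ∈ F → w ≢ a → (d x a <∞ d x w) ⊎ (d x a ≡ d x w × prio w ℕ.< prio a)
        owns w w∈F w≢a with a≤all w (∈-allFin w) w∈F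
        ... | inj₁ lt       = inj₁ lt
        ... | inj₂ (e , le) = inj₂ (e , ℕP.≤∧≢⇒< le (λ prio≡ → w≢a (prio-inj prio≡)))

x∈p─q⁺ : ∀ {n} {x : Fin n} (p q : Subset n) → x ∈ p → x ∉ q → x ∈ p ─ q
x∈p─q⁺ (inside ∷ p) (outside ∷ q) here        x∉q = here
x∈p─q⁺ (inside ∷ p) (inside ∷ q)  here        x∉q = ⊥-elim (x∉q here)
x∈p─q⁺ (_ ∷ p)      (_ ∷ q)       (there x∈p) x∉q = there (x∈p─q⁺ p q x∈p (λ x∈q → x∉q (there x∈q)))

x∈⋃⁺ : ∀ {n} {x : Fin n} {S : Subset n} (Ss : List (Subset n)) → S ∈ₗ Ss → x ∈ S → x ∈ ⋃ Ss
x∈⋃⁺ (_ ∷ Ss) (here refl)  x∈S = x∈p∪q⁺ (inj₁ x∈S)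
x∈⋃⁺ (_ ∷ Ss) (there S∈Ss) x∈S = x∈p∪q⁺ (inj₂ (x∈⋃⁺ Ss S∈Ss x∈S))

∈-tabulate⁺ : ∀ {n} (f : Fin n → Bool) {x} → f x ≡ true → x ∈ tabulate f
∈-tabulate⁺ f {x} fx = lookup⇒[]= x (tabulate f) (trans (lookup∘tabulate f x) fx)

∈-tabulate⁻ : ∀ {n} (f : Fin n → Bool) {x} → x ∈ tabulate f → f x ≡ true
∈-tabulate⁻ f {x} x∈ = trans (sym (lookup∘tabulate f x)) ([]=⇒lookup x∈)

true≢false : true ≢ false
true≢false ()

∧-true : ∀ {a b} → a ∧ b ≡ true → a ≡ true × b ≡ true
∧-true {true} {true} _ = refl , refl

any-witness : ∀ {A : Set} (p : A → Bool) {xs x} → x ∈ₗ xs → p x ≡ true → any p xs ≡ true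
any-witness p x∈xs px =
  Equivalence.to BoolP.T-≡ (any⁺ p (lose x∈xs (Equivalence.from BoolP.T-≡ px)))

module Region {n : ℕ} (E : Edges n) (d : Fin n → Fin n → ℚ∞) (spd : IsShortestPathDist E d)
  (L G : Subset n) (prio : Fin n → ℕ) (prio-inj : Injective _≡_ _≡_ prio)
  {k : ℕ} (hat : Fin n → Fin k) (adjK : Fin k → Fin k → Bool)
  (vor : IsVoronoiContraction E d (L ∪ G) prio k hat adjK)
  {κ : ℕ} (VS : Fin κ → Subset k) (ES : Fin κ → Fin k → Fin k → Bool)
  (edges-inside : ∀ j a b → ES j a b ≡ true → adjK a b ≡ true × a ∈ VS j × b ∈ VS j)
  (i : Fin κ) where

  open Geodesics E d spd

  F : Subset n
  F = L ∪ G

  open VoronoiCells F prio prio-inj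

  M : Subset n
  M = Mset L G hat adjK VS ES i

  inHᵢ : Fin n → Bool
  inHᵢ y = lookup (VS i) (hat y)

  Boundary : Fin n → Set
  Boundary y = isBoundary adjK VS ES i (hat y) ≡ true

  Vᵢ : Subset n
  Vᵢ = Vset F hat VS i

  G' : Subset n
  G' = G ∪ ⋃ (map (Bset F hat adjK VS ES) (allFin κ))

  ∉Vᵢ : ∀ {a} → inHᵢ a ≡ false → a ∉ Vᵢ
  ∉Vᵢ a∉H a∈V = true≢false (trans (sym (proj₂ (∧-true (∈-tabulate⁻ _ a∈V)))) a∉H)

  M-from-L : ∀ {a} → a ∈ L → inHᵢ a ≡ false → a ∈ M
  M-from-L a∈L a∉H = x∈p∪q⁺ (inj₁ (x∈p─q⁺ L (L ∩ Vᵢ) a∈L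
    (λ a∈Lᵢ → ∉Vᵢ a∉H (proj₂ (x∈p∩q⁻ L Vᵢ a∈Lᵢ)))))

  M-from-G'ᵢ : ∀ {a} → a ∈ G' → a ∈ F → inHᵢ a ≡ true → a ∈ M
  M-from-G'ᵢ a∈G' a∈F a∈H =
    x∈p∪q⁺ (inj₂ (x∈p∩q⁺ (a∈G' , ∈-tabulate⁺ _ (cong₂ _∧_ ([]=⇒lookup a∈F) a∈H))))

  M-from-G : ∀ {a} → a ∈ G → inHᵢ a ≡ true → a ∈ M
  M-from-G a∈G = M-from-G'ᵢ (x∈p∪q⁺ (inj₁ a∈G)) (x∈p∪q⁺ (inj₂ a∈G))

  M-from-boundary : ∀ {a} → a ∈ F → Boundary a → a ∈ M
  M-from-boundary a∈F a-bd = M-from-G'ᵢ (x∈p∪q⁺ (inj₂ a∈Bᵢ)) a∈F (proj₁ (∧-true a-bd))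
    where
      a∈Bᵢ = x∈⋃⁺ (map (Bset F hat adjK VS ES) (allFin κ)) (∈-map⁺ _ (∈-allFin i))
               (∈-tabulate⁺ _ (cong₂ _∧_ ([]=⇒lookup a∈F) a-bd))

  -- An edge of the input graph leaving Hᵢ survives in G_Vor(F) but is not an edge of Hᵢ,
  -- so its endpoint inside Hᵢ is a boundary vertex.
  crossing-boundary : ∀ {x y w} → WAdj E x y w → inHᵢ x ≡ true → inHᵢ y ≡ false → Boundary x
  crossing-boundary {x} {y} {w} e x∈H y∉H = cong₂ _∧_ x∈H (any-witness _ (∈-allFin (hat y)) leaves)
    where
      hat≢ : hat x ≢ hat y
      hat≢ hx≡hy = true≢false (trans (sym x∈H) (trans (cong (lookup (VS i)) hx≡hy) y∉H))

      in-Vor : adjK (hat x) (hat y) ≡ true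
      in-Vor = proj₂ (proj₂ (proj₂ vor) (hat x) (hat y))
        (hat≢ , x , y , ((λ x≡y → hat≢ (cong hat x≡y)) , w , e) , refl , refl)

      not-in-Hᵢ : ES i (hat x) (hat y) ≡ false
      not-in-Hᵢ = BoolP.¬-not λ in-Hᵢ →
        true≢false (trans (sym ([]=⇒lookup (proj₂ (proj₂ (edges-inside i _ _ in-Hᵢ))))) y∉H)

      leaves : adjK (hat x) (hat y) ∧ not (ES i (hat x) (hat y)) ≡ true
      leaves = cong₂ (λ b e → b ∧ not e) in-Vor not-in-Hᵢ

  -- The boundary shortcut: if x lies on a shortest path from c to a facility t and
  -- x̂ is a boundary vertex of Hᵢ, then the owner a of x is in Mⁱ (â = x̂ ∈ ∂Hᵢ)
  -- and d(c,a) ≤ d(c,x) + d(x,a) ≤ d(c,x) + d(x,t) = d(c,t).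
  boundary-shortcut : ∀ c {t x T} → t ∈ F → d c t ≡ fin T → Between c t x → Boundary x →
                      minOver M (d c) ≤∞ fin T
  boundary-shortcut c {t} {x} {T} t∈F dct btw x-bd with owner x t∈F
  ... | a , x∈a , dxa≤dxt = begin
    minOver M (d c)    ≲⟨ minOver-≤ M (d c) a∈M ⟩
    d c a              ≲⟨ triangle c x a ⟩
    d c x +∞ d x a     ≲⟨ +∞-mono ≤∞-refl dxa≤dxt ⟩
    d c x +∞ d x t     ≲⟨ btw ⟩
    d c t              ≡⟨ dct ⟩
    fin T              ∎
    where
      dxa-fin : ∃ λ D → d x a ≡ fin D
      dxa-fin with proj₂ (+∞≤fin⇒fin (d c x) (d x t) (subst ((d c x +∞ d x t) ≤∞_) dct btw))
      ... | _ , dxt = ≤fin⇒fin (≤∞-trans dxa≤dxt (≤∞-reflexive dxt))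

      hat-x≡hat-a : hat x ≡ hat a
      hat-x≡hat-a = proj₂ (proj₁ (proj₂ vor) x a) (contracted-with-owner x∈a (proj₂ dxa-fin))

      a∈M : a ∈ M
      a∈M = M-from-boundary (proj₁ x∈a)
              (subst (λ h → isBoundary adjK VS ES i h ≡ true) hat-x≡hat-a x-bd)

  -- If exactly one of ĉ, t̂ lies in Hᵢ, then Mⁱ serves c at least as well as t:
  -- a shortest c–t path leaves Hᵢ through a boundary vertex.
  region-crossing : ∀ c {t T} → t ∈ F → d c t ≡ fin T → inHᵢ c ≢ inHᵢ t → minOver M (d c) ≤∞ fin T
  region-crossing c t∈F dct Hc≢Ht = through (geodesic-crossing inHᵢ Hc≢Ht dct)
    where
      through : Crossing inHᵢ c _ → minOver M (d c) ≤∞ fin _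
      through record { u = u ; v = v ; edge = e ; changes = H≢ ; u-between = u-btw ; v-between = v-btw }
        with inHᵢ u in u∈H | inHᵢ v in v∈H
      ... | true  | false = boundary-shortcut c t∈F dct u-btw (crossing-boundary e u∈H v∈H)
      ... | false | true  = boundary-shortcut c t∈F dct v-btw (crossing-boundary (WAdj-sym e) v∈H u∈H)
      ... | true  | true  = ⊥-elim (H≢ refl)
      ... | false | false = ⊥-elim (H≢ refl)

  -- If ĉ is internal to Hᵢ then m_c ≤ g_c: the nearest G-facility g is in Mⁱ if ĝ ∈ Hᵢ,
  -- and otherwise c and g are separated by Hᵢ.
  internal-bound : ∀ c → IsInternal adjK VS ES i (hat c) → minOver M (d c) ≤∞ minOver G (d c)
  internal-bound c (c∈H , _) with minOver-attained G (d c)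
  ... | inj₁ g≡∞ = subst (minOver M (d c) ≤∞_) (sym g≡∞) (_ ≤∞∞)
  ... | inj₂ (g , g∈G , g≡dcg) = subst (minOver M (d c) ≤∞_) (sym g≡dcg) (to-g (d c g) refl)
    where
      to-g : ∀ δ → d c g ≡ δ → minOver M (d c) ≤∞ δ
      to-g ∞       _   = _ ≤∞∞
      to-g (fin γ) dcg with inHᵢ g BoolP.≟ true
      ... | yes g∈H = subst (minOver M (d c) ≤∞_) dcg (minOver-≤ M (d c) (M-from-G g∈G g∈H))
      ... | no g∉H  = region-crossing c (x∈p∪q⁺ (inj₂ g∈G)) dcg (λ Hc≡Hg → g∉H (trans (sym Hc≡Hg) c∈H))

  -- If ĉ is not internal to Hᵢ then m_c ≤ ℓ_c, for the nearest L-facility l: either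
  -- l̂ ∉ Hᵢ and l ∈ Mⁱ, or ĉ ∉ Hᵢ and Hᵢ separates c from l, or ĉ is a boundary vertex.
  external-bound : ∀ c {ℓ} → minOver L (d c) ≡ fin ℓ → ¬ IsInternal adjK VS ES i (hat c) →
                   minOver M (d c) ≤∞ fin ℓ
  external-bound c ℓ-min not-internal with minOver-attained L (d c)
  ... | inj₁ l≡∞ with trans (sym ℓ-min) l≡∞
  ...   | ()
  external-bound c ℓ-min not-internal | inj₂ (l , l∈L , l≡dcl) with inHᵢ l BoolP.≟ true
  ... | no l∉H = subst (minOver M (d c) ≤∞_) (trans (sym l≡dcl) ℓ-min)
                   (minOver-≤ M (d c) (M-from-L l∈L (BoolP.¬-not l∉H)))
  ... | yes l∈H with inHᵢ c BoolP.≟ true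
  ...   | no c∉H = region-crossing c (x∈p∪q⁺ (inj₁ l∈L)) (trans (sym l≡dcl) ℓ-min)
                     (λ Hc≡Hl → c∉H (trans Hc≡Hl l∈H))
  ...   | yes c∈H = boundary-shortcut c (x∈p∪q⁺ (inj₁ l∈L)) (trans (sym l≡dcl) ℓ-min)
                      (source-between c l) (BoolP.¬-not (λ c-bd → not-internal (c∈H , c-bd)))

lemma5 : (𝒦 : SGraph → Set) → MinorClosed 𝒦 → Nontrivial 𝒦 →
    (n : ℕ) (E : Edges n) → NonNegWeights E → 𝒦 (underlying E) →
    (d : Fin n → Fin n → ℚ∞) → IsShortestPathDist E d →
    (C : Subset n) → 1 ≤ ∣ C ∣ → (f : ℚ) → 0ℚ < f → (p : ℕ) → 1 ≤ p →
    (s : ℕ) (ε : ℚ) → 0ℚ < ε → (r : ℚ) → r * (ε * ε) ≡ 1ℚ →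
    (L G : Subset n) → IsLocalSearchOutput d C f p s ε L → IsMinimumCost d C f p G →
    (prio : Fin n → ℕ) → Injective _≡_ _≡_ prio →
    (k : ℕ) (hat : Fin n → Fin k) (adjK : Fin k → Fin k → Bool) →
    IsVoronoiContraction E d (L ∪ G) prio k hat adjK →
    (c₁ c₂ : ℚ) (κ : ℕ) (VS : Fin κ → Subset k) (ES : Fin κ → Fin k → Fin k → Bool) →
    IsWeakRDivision k adjK ε r c₁ c₂ κ VS ES →
    (c : Fin n) (i : Fin κ) (ℓc : ℚ) → minOver L (d c) ≡ fin ℓc →
    (IsInternal adjK VS ES i (hat c) →
      (minOver (Mset L G hat adjK VS ES i) (d c) -∞ ℓc) ≤∞ (minOver G (d c) -∞ ℓc)) ×
    (¬ IsInternal adjK VS ES i (hat c) →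
      (minOver (Mset L G hat adjK VS ES i) (d c) -∞ ℓc) ≤∞ fin 0ℚ)
lemma5 _ _ _ _ E _ _ d spd _ _ _ _ _ _ _ _ _ _ _ L G _ _ prio prio-inj _ hat adjK vor
       _ _ _ VS ES r-division c i ℓc ℓ-min =
    (λ internal → -∞-mono ℓc (internal-bound c internal))
  , (λ not-internal → -∞-≤0 ℓc (external-bound c ℓ-min not-internal))
  where
    open Region E d spd L G prio prio-inj hat adjK vor VS ES (proj₁ r-division) i
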